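{- Let $\mathcal P=\mathcal P_0\mapsto \mathcal P_1\mapsto\cdots\mapsto\mathcal P_N=\mathcal Q$ be a sequence of pipe dreams in which each step $\mathcal P_t\mapsto\mathcal P_{t+1}$ is a ladder move. Then every ladder move in this sequence is simple if and only if $a_{\mathcal P}(k)=a_{\mathcal Q}(k)$ for all $k\geq 1$.
   Context: A pipe dream is identified with a finite set $\mathcal P\subset\mathbb Z_{>0}\times\mathbb Z_{>0}$ (positions of "pluses"; all other positions are "elbows"), with rows and columns indexed in matrix notation ($(i,j)$ = row $i$ from the top, column $j$ from the left). For $k\geq1$, $a_{\mathcal P}(k):=\#\{(i,j)\in\mathcal P: i+j-1=k\}$, the number of pluses on the $k$th antidiagonal. A ladder move transforms $\mathcal P$ into $\mathcal P'$ as follows: suppose for some $r,c\geq1$ and $m\geq 0$ we have $(r,c),(r,c+1)\notin\mathcal P$, $(r+t,c),(r+t,c+1)\in\mathcal P$ for all $1\leq t\leq m$, $(r+m+1,c)\in\mathcal P$ and $(r+m+1,c+1)\notin\mathcal P$; then $\mathcal P':=(\mathcal P\setminus\{(r+m+1,c)\})\cup\{(r,c+1)\}$. The ladder move is simple if $m=0$, i.e. it removes a plus at $(i+1,j-1)$ and adds a plus at $(i,j)$, where $(i,j-1),(i,j),(i+1,j)\notin\mathcal P$. -}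

module Defs where

open import Data.Nat using (ℕ; zero; suc; _+_; _∸_; _≤_)
open import Data.Nat.Properties using (_≟_)
open import Data.Product using (_×_; _,_; proj₁; proj₂; ∃-syntax)
open import Data.List using (List; length; filter)
open import Data.List.Relation.Unary.All using (All)
open import Data.List.Relation.Unary.Unique.Propositional using (Unique)
open import Data.List.Membership.Propositional using (_∈_; _∉_)
open import Data.Sum using (_⊎_)
open import Relation.Binary.PropositionalEquality using (_≡_; _≢_)
open import Relation.Nullary using (¬_)
open import Function.Bundles using (_⇔_)

-- A position (i , j) = row i (from the top), column j (from the left); 1-based.
Pos : Set
Pos = ℕ × ℕ

-- A pipe dream: a finite set of positions in ℤ>0 × ℤ>0 (the pluses),
-- represented by a duplicate-free list.
record PipeDream : Set where
  field
    pluses   : List Pos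
    unique   : Unique pluses
    positive : All (λ p → (1 ≤ proj₁ p) × (1 ≤ proj₂ p)) pluses
open PipeDream public

_∈P_ : Pos → PipeDream → Set
p ∈P P = p ∈ pluses P

_∉P_ : Pos → PipeDream → Set
p ∉P P = ¬ (p ∈P P)

a : PipeDream → ℕ → ℕ
a P k = length (filter (λ p → (proj₁ p + proj₂ p ∸ 1) ≟ k) (pluses P))

IsUpdate : PipeDream → Pos → Pos → PipeDream → Set
IsUpdate P rem add P' =
  ∀ x → (x ∈P P') ⇔ (((x ∈P P) × (x ≢ rem)) ⊎ (x ≡ add))

LadderMoveAt : ℕ → ℕ → ℕ → PipeDream → PipeDream → Set
LadderMoveAt r c m P P' =
  (1 ≤ r) × (1 ≤ c)
  × ((r , c) ∉P P) × ((r , c + 1) ∉P P)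
  × (∀ t → 1 ≤ t → t ≤ m → ((r + t , c) ∈P P) × ((r + t , c + 1) ∈P P))
  × ((r + m + 1 , c) ∈P P) × ((r + m + 1 , c + 1) ∉P P)
  × IsUpdate P (r + m + 1 , c) (r , c + 1) P'

LadderMove : PipeDream → PipeDream → Set
LadderMove P P' = ∃[ r ] ∃[ c ] ∃[ m ] LadderMoveAt r c m P P'

SimpleLadderMove : PipeDream → PipeDream → Set
SimpleLadderMove P P' = ∃[ r ] ∃[ c ] LadderMoveAt r c 0 P P'

module Submission where

-- Write diag (i , j) = i + j - 1 for the antidiagonal of a
-- position and, for K : ℕ, let  below K P  be the number of pluses of P
-- on antidiagonals < K.  A ladder move at corner (r , c) with parameter m
-- removes a plus on antidiagonal r + c + m and adds one on antidiagonal
-- r + c.  Hence: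
--   * a simple move (m = 0) preserves every a(k), so a whole sequence of
--     simple moves preserves a;                                   (⇒)
--   * every move weakly increases every  below K, and a non-simple move
--     (m ≥ 1) strictly increases  below (r + c + m).  Since  below K  is
--     determined by a(1), …, a(K-1), equal a-vectors at both ends of the
--     sequence force every  below K  to be constant along it, so no
--     non-simple move can occur.                                  (⇐)
-- The file first proves counting facts for finite lists (counts along a
-- set update, along a disjoint split of a predicate), then the effect of
-- a single ladder move on a and on  below, then a chaining lemma for
-- sequences, and finally the theorem.

open import Defs
open import Data.Nat using (ℕ; zero; suc; _+_; _∸_; _≤_; _<_; _<?_; z≤n; s≤s; z<s)
open import Data.Nat.Properties
  using (_≟_; +-comm; +-suc; +-identityʳ; +-cancelʳ-≡; +-cancelʳ-≤; +-monoʳ-≤; +-commutativeSemigroup;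
         ≤-refl; ≤-trans; ≤-antisym; ≤-reflexive; m≤m+n; m<m+n; n≮n; <-irrefl; <⇒≢;
         m<n⇒m<1+n; m<1+n⇒m<n∨m≡n; 1+n≢0; module ≤-Reasoning)
open import Data.Fin using (Fin; zero; fromℕ; inject₁)
open import Data.Product using (_×_; _,_; proj₁; proj₂)
open import Data.Product.Properties using (≡-dec)
open import Data.Sum using (_⊎_; inj₁; inj₂; [_,_])
open import Data.Empty using (⊥-elim)
open import Data.List using (List; []; _∷_; length; filter)
open import Data.List.Properties using (filter-none)
open import Data.List.Relation.Unary.All as All using (All; []; _∷_)
open import Data.List.Relation.Unary.Any using (here; there)
open import Data.List.Relation.Unary.Unique.Propositional using (Unique)
open import Data.List.Relation.Unary.AllPairs using (_∷_)
open import Data.List.Relation.Unary.Unique.Propositional.Properties using () renaming (filter⁺ to unique-filter)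
open import Data.List.Membership.Propositional using (_∈_)
open import Data.List.Membership.Propositional.Properties using (∈-filter⁺; ∈-filter⁻)
open import Data.List.Membership.Propositional.Properties.WithK using (unique∧set⇒bag)
open import Data.List.Relation.Binary.BagAndSetEquality using (∼bag⇒↭)
open import Data.List.Relation.Binary.Permutation.Propositional using (_↭_)
open import Data.List.Relation.Binary.Permutation.Propositional.Properties using (↭-length; filter-↭)
open import Relation.Binary.Definitions using (DecidableEquality)
open import Relation.Binary.PropositionalEquality using (_≡_; _≢_; refl; sym; trans; cong; cong₂; subst; module ≡-Reasoning)
open import Relation.Nullary using (¬_; yes; no; ¬?)
open import Relation.Unary using (Decidable)
open import Function.Bundles using (_⇔_; mk⇔; Equivalence)
open import Algebra.Properties.CommutativeSemigroup +-commutativeSemigroup using (interchange; xy∙z≈zy∙x; xy∙z≈xz∙y)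

private
  variable
    A : Set
    r c m : ℕ

count : {Q : A → Set} → Decidable Q → List A → ℕ
count Q? xs = length (filter Q? xs)

indicator : {Q : A → Set} → Decidable Q → A → ℕ
indicator Q? x with Q? x
... | yes _ = 1
... | no  _ = 0

count-∷ : {Q : A → Set} (Q? : Decidable Q) (x : A) (xs : List A)
  → count Q? (x ∷ xs) ≡ indicator Q? x + count Q? xs
count-∷ Q? x xs with Q? x
... | yes _ = refl
... | no  _ = refl

indicator-yes : {Q : A → Set} (Q? : Decidable Q) {x : A} → Q x → indicator Q? x ≡ 1
indicator-yes Q? {x} q with Q? x
... | yes _  = refl
... | no ¬q  = ⊥-elim (¬q q)

indicator-no : {Q : A → Set} (Q? : Decidable Q) {x : A} → ¬ Q x → indicator Q? x ≡ 0
indicator-no Q? {x} ¬q with Q? x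
... | yes q = ⊥-elim (¬q q)
... | no  _ = refl

indicator-mono : {Q : A → Set} (Q? : Decidable Q) {x y : A} → (Q x → Q y) → indicator Q? x ≤ indicator Q? y
indicator-mono Q? {x} {y} x⇒y with Q? x | Q? y
... | yes _ | yes _  = ≤-refl
... | yes q | no ¬q  = ⊥-elim (¬q (x⇒y q))
... | no  _ | _      = z≤n

count-↭ : {Q : A → Set} (Q? : Decidable Q) {xs ys : List A} → xs ↭ ys → count Q? xs ≡ count Q? ys
count-↭ Q? xs↭ys = ↭-length (filter-↭ Q? xs↭ys)

same-members⇒↭ : {xs ys : List A} → Unique xs → Unique ys
  → (∀ {x} → (x ∈ xs) ⇔ (x ∈ ys)) → xs ↭ ys
same-members⇒↭ !xs !ys same = ∼bag⇒↭ (unique∧set⇒bag !xs !ys same)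

count-none : {Q : A → Set} (Q? : Decidable Q) (xs : List A) → All (λ x → ¬ Q x) xs → count Q? xs ≡ 0
count-none Q? xs none = cong length (filter-none Q? none)

indicator-⊎ : {Q Q₁ Q₂ : A → Set} (Q? : Decidable Q) (Q₁? : Decidable Q₁) (Q₂? : Decidable Q₂)
  → (∀ x → Q x ⇔ (Q₁ x ⊎ Q₂ x)) → (∀ {x} → Q₁ x → ¬ Q₂ x)
  → ∀ x → indicator Q? x ≡ indicator Q₁? x + indicator Q₂? x
indicator-⊎ Q? Q₁? Q₂? split disjoint x with Q? x | Q₁? x | Q₂? x
... | yes _ | yes q₁  | yes q₂  = ⊥-elim (disjoint q₁ q₂)
... | yes _ | yes _   | no  _   = refl
... | yes _ | no  _   | yes _   = refl
... | yes q | no  ¬q₁ | no  ¬q₂ = ⊥-elim ([ ¬q₁ , ¬q₂ ] (Equivalence.to (split x) q))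
... | no ¬q | yes q₁  | _       = ⊥-elim (¬q (Equivalence.from (split x) (inj₁ q₁)))
... | no ¬q | no  _   | yes q₂  = ⊥-elim (¬q (Equivalence.from (split x) (inj₂ q₂)))
... | no  _ | no  _   | no  _   = refl

count-⊎ : {Q Q₁ Q₂ : A → Set} (Q? : Decidable Q) (Q₁? : Decidable Q₁) (Q₂? : Decidable Q₂)
  → (∀ x → Q x ⇔ (Q₁ x ⊎ Q₂ x)) → (∀ {x} → Q₁ x → ¬ Q₂ x)
  → (xs : List A) → count Q? xs ≡ count Q₁? xs + count Q₂? xs
count-⊎ Q? Q₁? Q₂? split disjoint [] = refl
count-⊎ Q? Q₁? Q₂? split disjoint (x ∷ xs) = begin
  count Q? (x ∷ xs)                                   ≡⟨ count-∷ Q? x xs ⟩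
  indicator Q? x + count Q? xs                        ≡⟨ cong₂ _+_ (indicator-⊎ Q? Q₁? Q₂? split disjoint x)
                                                                   (count-⊎ Q? Q₁? Q₂? split disjoint xs) ⟩
  (indicator Q₁? x + indicator Q₂? x) + (count Q₁? xs + count Q₂? xs)
                                                      ≡⟨ interchange (indicator Q₁? x) _ _ _ ⟩
  (indicator Q₁? x + count Q₁? xs) + (indicator Q₂? x + count Q₂? xs)
                                                      ≡⟨ sym (cong₂ _+_ (count-∷ Q₁? x xs) (count-∷ Q₂? x xs)) ⟩
  count Q₁? (x ∷ xs) + count Q₂? (x ∷ xs)             ∎
  where open ≡-Reasoning

count-update : {A : Set} → DecidableEquality A → {Q : A → Set} (Q? : Decidable Q) {xs ys : List A} {rem add : A}
  → Unique xs → Unique ys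
  → (∀ x → (x ∈ ys) ⇔ (((x ∈ xs) × (x ≢ rem)) ⊎ (x ≡ add)))
  → rem ∈ xs → ¬ (add ∈ xs)
  → count Q? ys + indicator Q? rem ≡ count Q? xs + indicator Q? add
count-update {A} _≟_ Q? {xs} {ys} {rem} {add} !xs !ys update rem∈xs add∉xs = begin
  count Q? ys + indicator Q? rem                        ≡⟨ cong (_+ indicator Q? rem) (count-↭ Q? ys↭add∷rest) ⟩
  count Q? (add ∷ rest) + indicator Q? rem              ≡⟨ cong (_+ indicator Q? rem) (count-∷ Q? add rest) ⟩
  (indicator Q? add + count Q? rest) + indicator Q? rem ≡⟨ xy∙z≈zy∙x (indicator Q? add) _ _ ⟩
  (indicator Q? rem + count Q? rest) + indicator Q? add ≡⟨ cong (_+ indicator Q? add) (count-∷ Q? rem rest) ⟨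
  count Q? (rem ∷ rest) + indicator Q? add              ≡⟨ cong (_+ indicator Q? add) (count-↭ Q? xs↭rem∷rest) ⟨
  count Q? xs + indicator Q? add                        ∎
  where
  open ≡-Reasoning
  ≢rem? : Decidable (_≢ rem)
  ≢rem? x = ¬? (x ≟ rem)
  rest : List A
  rest = filter ≢rem? xs
  !rest : Unique rest
  !rest = unique-filter ≢rem? !xs
  ys↭add∷rest : ys ↭ add ∷ rest
  ys↭add∷rest = same-members⇒↭ !ys (add∉rest ∷ !rest) (mk⇔ to from)
    where
    add∉rest : All (add ≢_) rest
    add∉rest = All.tabulate λ y∈rest add≡y →
      add∉xs (subst (_∈ xs) (sym add≡y) (proj₁ (∈-filter⁻ ≢rem? {xs = xs} y∈rest)))
    to : ∀ {x} → x ∈ ys → x ∈ add ∷ rest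
    to {x} x∈ys with Equivalence.to (update x) x∈ys
    ... | inj₁ (x∈xs , x≢rem) = there (∈-filter⁺ ≢rem? x∈xs x≢rem)
    ... | inj₂ x≡add          = here x≡add
    from : ∀ {x} → x ∈ add ∷ rest → x ∈ ys
    from {x} (here x≡add)   = Equivalence.from (update x) (inj₂ x≡add)
    from {x} (there x∈rest) = Equivalence.from (update x) (inj₁ (∈-filter⁻ ≢rem? {xs = xs} x∈rest))
  xs↭rem∷rest : xs ↭ rem ∷ rest
  xs↭rem∷rest = same-members⇒↭ !xs (rem∉rest ∷ !rest) (mk⇔ to from)
    where
    rem∉rest : All (rem ≢_) rest
    rem∉rest = All.tabulate λ y∈rest rem≡y → proj₂ (∈-filter⁻ ≢rem? {xs = xs} y∈rest) (sym rem≡y)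
    to : ∀ {x} → x ∈ xs → x ∈ rem ∷ rest
    to {x} x∈xs with x ≟ rem
    ... | yes x≡rem = here x≡rem
    ... | no  x≢rem = there (∈-filter⁺ ≢rem? x∈xs x≢rem)
    from : ∀ {x} → x ∈ rem ∷ rest → x ∈ xs
    from (here refl)    = rem∈xs
    from (there x∈rest) = proj₁ (∈-filter⁻ ≢rem? {xs = xs} x∈rest)

diag : Pos → ℕ
diag p = proj₁ p + proj₂ p ∸ 1

on-diag? : (k : ℕ) → Decidable (λ p → diag p ≡ k)
on-diag? k p = diag p ≟ k

below-diag? : (K : ℕ) → Decidable (λ p → diag p < K)
below-diag? K p = diag p <? K

below : ℕ → PipeDream → ℕ
below K P = count (below-diag? K) (pluses P)

_≟ₚ_ : DecidableEquality Pos
_≟ₚ_ = ≡-dec _≟_ _≟_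

diag-added : ∀ r c → diag (r , c + 1) ≡ r + c
diag-added r c = cong (_∸ 1) (trans (cong (r +_) (+-comm c 1)) (+-suc r c))

diag-removed : ∀ r c m → diag (r + m + 1 , c) ≡ r + c + m
diag-removed r c m = begin
  r + m + 1 + c ∸ 1   ≡⟨ cong (λ z → z + c ∸ 1) (+-comm (r + m) 1) ⟩
  r + m + c           ≡⟨ xy∙z≈xz∙y r m c ⟩
  r + c + m           ∎
  where open ≡-Reasoning

diag-positive : {p : Pos} → (1 ≤ proj₁ p) × (1 ≤ proj₂ p) → diag p ≢ 0
diag-positive {suc i , suc j} _ diag≡0 = 1+n≢0 (trans (sym (+-suc i j)) diag≡0)

a-zero : (P : PipeDream) → a P 0 ≡ 0
a-zero P = count-none (on-diag? 0) (pluses P) (All.map diag-positive (positive P))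

below-zero : (P : PipeDream) → below 0 P ≡ 0
below-zero P = count-none (below-diag? 0) (pluses P) (All.tabulate λ _ ())

below-suc : (K : ℕ) (P : PipeDream) → below (suc K) P ≡ below K P + a P K
below-suc K P = count-⊎ (below-diag? (suc K)) (below-diag? K) (on-diag? K)
  (λ p → mk⇔ m<1+n⇒m<n∨m≡n [ m<n⇒m<1+n , (λ d≡K → s≤s (≤-reflexive d≡K)) ])
  <⇒≢ (pluses P)

-- Since a P 0 = 0, the numbers a P 1, a P 2, … determine every below K P.
below-determined-by-a : (P P′ : PipeDream) → (∀ k → 1 ≤ k → a P k ≡ a P′ k)
  → ∀ K → below K P ≡ below K P′
below-determined-by-a P P′ same-a zero = trans (below-zero P) (sym (below-zero P′))
below-determined-by-a P P′ same-a (suc K) = begin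
  below (suc K) P       ≡⟨ below-suc K P ⟩
  below K P + a P K     ≡⟨ cong₂ _+_ (below-determined-by-a P P′ same-a K) (same-a₀ K) ⟩
  below K P′ + a P′ K   ≡⟨ below-suc K P′ ⟨
  below (suc K) P′      ∎
  where
  open ≡-Reasoning
  same-a₀ : ∀ k → a P k ≡ a P′ k
  same-a₀ zero    = trans (a-zero P) (sym (a-zero P′))
  same-a₀ (suc k) = same-a (suc k) (s≤s z≤n)

ladder-balance : {Q : Pos → Set} (Q? : Decidable Q) (P P′ : PipeDream) → LadderMoveAt r c m P P′
  → count Q? (pluses P′) + indicator Q? (r + m + 1 , c) ≡ count Q? (pluses P) + indicator Q? (r , c + 1)
ladder-balance Q? P P′ (_ , _ , _ , add∉P , _ , rem∈P , _ , update) =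
  count-update _≟ₚ_ Q? (unique P) (unique P′) update rem∈P add∉P

simple-move-preserves-a : (P P′ : PipeDream) → LadderMoveAt r c 0 P P′ → ∀ k → a P k ≡ a P′ k
simple-move-preserves-a {r} {c} P P′ move k = sym (+-cancelʳ-≡ [add] (a P′ k) (a P k) (begin
  a P′ k + [add]   ≡⟨ cong (a P′ k +_) [rem]≡[add] ⟨
  a P′ k + [rem]   ≡⟨ ladder-balance (on-diag? k) P P′ move ⟩
  a P k + [add]    ∎))
  where
  open ≡-Reasoning
  [add] [rem] : ℕ
  [add] = indicator (on-diag? k) (r , c + 1)
  [rem] = indicator (on-diag? k) (r + 0 + 1 , c)
  same-diag : diag (r + 0 + 1 , c) ≡ diag (r , c + 1)
  same-diag = trans (diag-removed r c 0) (trans (+-identityʳ (r + c)) (sym (diag-added r c)))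
  [rem]≡[add] : [rem] ≡ [add]
  [rem]≡[add] = ≤-antisym (indicator-mono (on-diag? k) (trans (sym same-diag)))
                          (indicator-mono (on-diag? k) (trans same-diag))

-- Every ladder move moves a plus to a weakly lower antidiagonal, so no
-- below K decreases.
ladder-below-mono : (P P′ : PipeDream) → LadderMoveAt r c m P P′ → ∀ K → below K P ≤ below K P′
ladder-below-mono {r} {c} {m} P P′ move K = +-cancelʳ-≤ [add] (below K P) (below K P′) (begin
  below K P + [add]    ≡⟨ ladder-balance (below-diag? K) P P′ move ⟨
  below K P′ + [rem]   ≤⟨ +-monoʳ-≤ (below K P′) [rem]≤[add] ⟩
  below K P′ + [add]   ∎)
  where
  open ≤-Reasoning
  [add] [rem] : ℕ
  [add] = indicator (below-diag? K) (r , c + 1)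
  [rem] = indicator (below-diag? K) (r + m + 1 , c)
  [rem]≤[add] : [rem] ≤ [add]
  [rem]≤[add] = indicator-mono (below-diag? K) λ rem<K → begin-strict
    diag (r , c + 1)        ≡⟨ diag-added r c ⟩
    r + c                   ≤⟨ m≤m+n (r + c) m ⟩
    r + c + m               ≡⟨ diag-removed r c m ⟨
    diag (r + m + 1 , c)    <⟨ rem<K ⟩
    K                       ∎

-- A non-simple ladder move (m ≥ 1) strictly increases below (r + c + m):
-- the removed plus lies on antidiagonal r + c + m, the added one below it.
ladder-below-strict : (P P′ : PipeDream) → LadderMoveAt r c (suc m) P P′ → below (r + c + suc m) P < below (r + c + suc m) P′
ladder-below-strict {r} {c} {m} P P′ move = ≤-reflexive (begin
  suc (below K P)       ≡⟨ +-comm 1 (below K P) ⟩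
  below K P + 1         ≡⟨ cong (below K P +_) [add]≡1 ⟨
  below K P + [add]     ≡⟨ ladder-balance (below-diag? K) P P′ move ⟨
  below K P′ + [rem]    ≡⟨ cong (below K P′ +_) [rem]≡0 ⟩
  below K P′ + 0        ≡⟨ +-identityʳ (below K P′) ⟩
  below K P′            ∎)
  where
  open ≡-Reasoning
  K [add] [rem] : ℕ
  K = r + c + suc m
  [add] = indicator (below-diag? K) (r , c + 1)
  [rem] = indicator (below-diag? K) (r + suc m + 1 , c)
  [add]≡1 : [add] ≡ 1
  [add]≡1 = indicator-yes (below-diag? K) (subst (_< K) (sym (diag-added r c)) (m<m+n (r + c) z<s))
  [rem]≡0 : [rem] ≡ 0
  [rem]≡0 = indicator-no (below-diag? K) λ rem<K → n≮n K (subst (_< K) (diag-removed r c (suc m)) rem<K)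

module Chain {A : Set} (R : A → A → Set)
             (R-refl : ∀ {x} → R x x) (R-trans : ∀ {x y z} → R x y → R y z → R x z) where

  Steps : (N : ℕ) → (Fin (suc N) → A) → Set
  Steps N f = ∀ (t : Fin N) → R (f (inject₁ t)) (f (Fin.suc t))

  from-first : ∀ N (f : Fin (suc N) → A) → Steps N f → ∀ i → R (f zero) (f i)
  from-first N       f steps zero        = R-refl
  from-first (suc N) f steps (Fin.suc i) =
    R-trans (from-first N (λ j → f (inject₁ j)) (λ t → steps (inject₁ t)) i) (steps i)

  to-last : ∀ N (f : Fin (suc N) → A) → Steps N f → ∀ i → R (f i) (f (fromℕ N))
  to-last zero    f steps zero        = R-refl
  to-last (suc N) f steps zero        =
    R-trans (steps zero) (to-last N (λ j → f (Fin.suc j)) (λ t → steps (Fin.suc t)) zero)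
  to-last (suc N) f steps (Fin.suc i) = to-last N (λ j → f (Fin.suc j)) (λ t → steps (Fin.suc t)) i

module ≡-Chain = Chain {ℕ} _≡_ refl trans
module ≤-Chain = Chain {ℕ} _≤_ ≤-refl ≤-trans

lemma3p2 : (N : ℕ) (P : Fin (suc N) → PipeDream)
    → (∀ (t : Fin N) → LadderMove (P (inject₁ t)) (P (Fin.suc t)))
    → (∀ (t : Fin N) → SimpleLadderMove (P (inject₁ t)) (P (Fin.suc t)))
    ⇔ (∀ (k : ℕ) → 1 ≤ k → a (P zero) k ≡ a (P (fromℕ N)) k)
lemma3p2 N P moves = mk⇔ all-simple⇒same-a same-a⇒all-simple
  where
  all-simple⇒same-a : (∀ t → SimpleLadderMove (P (inject₁ t)) (P (Fin.suc t)))
    → ∀ k → 1 ≤ k → a (P zero) k ≡ a (P (fromℕ N)) k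
  all-simple⇒same-a simple k _ = ≡-Chain.to-last N (λ i → a (P i) k)
    (λ t → simple-move-preserves-a (P (inject₁ t)) (P (Fin.suc t)) (proj₂ (proj₂ (simple t))) k) zero

  below-steps : ∀ K → ≤-Chain.Steps N (λ i → below K (P i))
  below-steps K t = ladder-below-mono (P (inject₁ t)) (P (Fin.suc t)) (proj₂ (proj₂ (proj₂ (moves t)))) K

  -- (⇐) a non-simple move at step t would give below K (P 0) < below K (P N),
  -- whereas equal antidiagonal counts at the ends force equality.
  same-a⇒all-simple : (∀ k → 1 ≤ k → a (P zero) k ≡ a (P (fromℕ N)) k)
    → ∀ t → SimpleLadderMove (P (inject₁ t)) (P (Fin.suc t))
  same-a⇒all-simple same-a t with moves t
  ... | r , c , zero  , move = r , c , move
  ... | r , c , suc m , move = ⊥-elim (<-irrefl (below-determined-by-a (P zero) (P (fromℕ N)) same-a K) (begin-strict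
    below K (P zero)          ≤⟨ ≤-Chain.from-first N (λ i → below K (P i)) (below-steps K) (inject₁ t) ⟩
    below K (P (inject₁ t))   <⟨ ladder-below-strict (P (inject₁ t)) (P (Fin.suc t)) move ⟩
    below K (P (Fin.suc t))   ≤⟨ ≤-Chain.to-last N (λ i → below K (P i)) (below-steps K) (Fin.suc t) ⟩
    below K (P (fromℕ N))     ∎))
    where
    open ≤-Reasoning
    K : ℕ
    K = r + c + suc m
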